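{- There exist $c',\xi>0$ and $n_0\in\mathbb{N}$ such that the following holds. Let $n\ge n_0$ be a multiple of $4$ and let $G$ be a tournament on $n$ vertices with $\delta^0(G)\ge(1/2-c')n$. Suppose there is a partition $\{V_1,V_2,V_3\}$ of $V(G)$ such that $|V_1|\equiv|V_2|\equiv|V_3|\equiv0\pmod4$ and, for every $i\in[3]$ and every $v\in V_i$, $d^+(v,V_{i+1})\ge(1/3-\xi)n$ and $d^-(v,V_{i-1})\ge(1/3-\xi)n$ (indices taken modulo $3$, so $V_0=V_3$, $V_4=V_1$). Then $G$ has a perfect $D$-tiling.
   Context: A tournament is a loopless directed graph with exactly one of $uv$, $vu$ per pair of distinct vertices; $\delta^0(G)$ is the minimum of all in- and out-degrees; $d^+(v,X)$ and $d^-(v,X)$ are the numbers of out- and in-neighbours of $v$ in $X$. $D=D_{1,1,2}$ is the tournament on vertices $a,b,c_1,c_2$ with edges $ab,bc_1,bc_2,c_1a,c_2a,c_1c_2$; a perfect $D$-tiling is a collection of vertex-disjoint copies of $D$ covering all vertices. -}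

module Defs where

open import Data.Nat using (ℕ; zero; suc; _+_)
open import Data.Bool using (Bool; true; false; not; _∧_)
open import Data.Fin using (Fin; zero; suc; _≟_)
open import Data.Product using (_×_; Σ; uncurry)
open import Data.Integer using (+_)
open import Data.Rational using (ℚ; _/_)
open import Relation.Binary.PropositionalEquality using (_≡_; _≢_)
open import Relation.Nullary using (does)
open import Function.Definitions using (Bijective)

ℕ→ℚ : ℕ → ℚ
ℕ→ℚ n = + n / 1

count : (n : ℕ) → (Fin n → Bool) → ℕ
count zero    p = 0
count (suc n) p = if′ (p zero) + count n (λ i → p (suc i))
  where
  if′ : Bool → ℕ
  if′ true  = 1
  if′ false = 0

record Tournament (n : ℕ) : Set where
  field
    adj     : Fin n → Fin n → Bool
    loopless : ∀ u → adj u u ≡ false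
    oneWay  : ∀ u v → u ≢ v → adj v u ≡ not (adj u v)
open Tournament public

outdeg : ∀ {n} → Tournament n → Fin n → ℕ
outdeg {n} G v = count n (λ w → adj G v w)

indeg : ∀ {n} → Tournament n → Fin n → ℕ
indeg {n} G v = count n (λ w → adj G w v)

outdegIn : ∀ {n} → Tournament n → (Fin n → Bool) → Fin n → ℕ
outdegIn {n} G X v = count n (λ w → adj G v w ∧ X w)

indegIn : ∀ {n} → Tournament n → (Fin n → Bool) → Fin n → ℕ
indegIn {n} G X v = count n (λ w → adj G w v ∧ X w)

MinSemidegreeAtLeast : ∀ {n} → Tournament n → ℚ → Set
MinSemidegreeAtLeast G m = ∀ v → (m Data.Rational.≤ ℕ→ℚ (outdeg G v)) × (m Data.Rational.≤ ℕ→ℚ (indeg G v))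

-- cyclic successor / predecessor on Fin 3 (indices of V₁,V₂,V₃ as 0,1,2)
next3 : Fin 3 → Fin 3
next3 zero = suc zero
next3 (suc zero) = suc (suc zero)
next3 (suc (suc zero)) = zero

prev3 : Fin 3 → Fin 3
prev3 zero = suc (suc zero)
prev3 (suc zero) = zero
prev3 (suc (suc zero)) = suc zero

inPart : ∀ {n} → (Fin n → Fin 3) → Fin 3 → Fin n → Bool
inPart part i w = does (part w ≟ i)

partSize : ∀ {n} → (Fin n → Fin 3) → Fin 3 → ℕ
partSize {n} part i = count n (inPart part i)

-- D = D_{1,1,2}: vertices a=0, b=1, c₁=2, c₂=3; edges ab, bc₁, bc₂, c₁a, c₂a, c₁c₂
a b c₁ c₂ : Fin 4
a = zero
b = suc zero
c₁ = suc (suc zero)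
c₂ = suc (suc (suc zero))

-- t : Fin 4 → Fin n spans a copy of D in G (injectivity is imposed by the tiling)
IsCopyOfD : ∀ {n} → Tournament n → (Fin 4 → Fin n) → Set
IsCopyOfD G t =
  (adj G (t a) (t b) ≡ true) × (adj G (t b) (t c₁) ≡ true) × (adj G (t b) (t c₂) ≡ true) ×
  (adj G (t c₁) (t a) ≡ true) × (adj G (t c₂) (t a) ≡ true) × (adj G (t c₁) (t c₂) ≡ true)

-- perfect D-tiling: k copies of D whose vertex maps together give a bijection
-- Fin k × Fin 4 → V(G) (vertex-disjoint, each copy injective, covering all vertices)
record PerfectDTiling {n : ℕ} (G : Tournament n) : Set where
  field
    k      : ℕ
    tiles  : Fin k → Fin 4 → Fin n
    copies : ∀ j → IsCopyOfD G (tiles j)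
    bij    : Bijective _≡_ _≡_ (uncurry tiles)

{-# OPTIONS --safe #-}
-- Take c′ = ξ = 1/300 and n₀ = 1. Write n = 4k and d = ⌊n/100⌋. The degree conditions make every part V_j larger than 33n/100,
-- hence smaller than 34n/100, so every vertex misses at most d out-neighbours in the next part and at
-- most d in-neighbours in the previous one. A copy of D of type t has a ∈ V_t, b ∈ V_{t+1} and
-- c₁, c₂ ∈ V_{t-1}, with a → b → cᵢ → a cyclic triangles. Taking |V_{t-1}| - k copies of type t uses up
-- every part exactly, and this number exceeds 6d. The copies of one type are then built by three perfect
-- matchings, a with b, then ab with c₁, then abc₁ with c₂, in bipartite graphs where every vertex has
-- at most 2d non-neighbours; such a matching is found greedily, rerouting one matched edge when stuck.
-- Finally c₁ and c₂ are named along the edge between them.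
module Submission where

open import Defs
import Algebra.Solver.CommutativeMonoid as CommutativeMonoidSolver
open import Data.Bool using (Bool; true; false; not; _∧_; T; if_then_else_)
open import Data.Bool.Properties using (T?; T-≡; T-∧; ∧-zeroʳ)
open import Data.Empty using (⊥; ⊥-elim)
open import Data.Fin using (Fin; zero; suc; _≟_; fromℕ<)
open import Data.Integer using (+_)
open import Data.List using (List; []; _∷_; _++_; length; map; concatMap; tabulate; allFin; filterᵇ; take; drop; lookup)
open import Data.List.Properties
  using (filter-++; length-++; length-map; length-tabulate; take++drop≡id; length-take; length-drop;
         ++-assoc; ++-identityʳ; concatMap-++)
open import Data.List.Membership.Propositional using (_∈_; find)
open import Data.List.Membership.Propositional.Properties
  using (∈-++⁺ˡ; ∈-++⁺ʳ; ∈-++⁻; ∈-∃++; ∈-map⁺; ∈-lookup; ∈-tabulate⁺; ∈-tabulate⁻; ∈-allFin; ∈-filter⁻)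
open import Data.List.Relation.Binary.Permutation.Propositional
  using (_↭_; ↭-refl; ↭-sym; ↭-trans; ↭-reflexive; prep; swap; ↭⇒↭ₛ)
open import Data.List.Relation.Binary.Permutation.Propositional.Properties
  using (filter-↭; ↭-length; ∈-resp-↭; All-resp-↭; map⁺; ++⁺ˡ; ++⁺ʳ; ++⁺; shift; ++-comm; ++-commutativeMonoid)
import Data.List.Relation.Binary.Permutation.Setoid.Properties as SetoidPermutation
open import Data.List.Relation.Unary.All as All using (All)
import Data.List.Relation.Unary.All.Properties as All
open import Data.List.Relation.Unary.Any using (Any; here; there; any?)
open import Data.List.Relation.Unary.Unique.Propositional using (Unique)
open import Data.List.Relation.Unary.Unique.Propositional.Properties using (allFin⁺)
open import Data.Nat using (ℕ; zero; suc; z≤n; s≤s; _≥_)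
open import Data.Nat.Divisibility using (_∣_)
open import Data.Product using (Σ; ∃; ∃-syntax; ∃₂; _×_; _,_; proj₁; proj₂; uncurry; map₁)
open import Data.Sum using (_⊎_; inj₁; inj₂)
open import Function using (_∘_; flip)
open import Function.Bundles using (Equivalence)
open import Function.Definitions using (Injective; Bijective)
open import Relation.Nullary using (¬_; yes; no; does)
open import Relation.Binary.PropositionalEquality
  using (_≡_; _≢_; refl; sym; trans; cong; cong₂; subst; subst₂; setoid; module ≡-Reasoning)

private
  variable
    A A′ B W : Set
    x : A
    xs ys zs X X′ : List A
    Y Y′ : List B

module Lists where

  open import Data.Nat using (_+_; _∸_; _⊓_; _≤_)
  open import Data.Nat.Properties
    using (≤-trans; ≤-reflexive; +-suc; +-monoʳ-≤; n≤1+n; m≤m+n; m≤n⇒m⊓n≡m; m+n∸m≡n)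

  countᵇ : (A → Bool) → List A → ℕ
  countᵇ p xs = length (filterᵇ p xs)

  countᵇ-++ : ∀ (p : A → Bool) xs ys → countᵇ p (xs ++ ys) ≡ countᵇ p xs + countᵇ p ys
  countᵇ-++ p xs ys = trans (cong length (filter-++ (T? ∘ p) xs ys)) (length-++ (filterᵇ p xs))

  countᵇ-↭ : ∀ (p : A → Bool) → xs ↭ ys → countᵇ p xs ≡ countᵇ p ys
  countᵇ-↭ p xs↭ys = ↭-length (filter-↭ (T? ∘ p) xs↭ys)

  countᵇ-map : ∀ (p : B → Bool) (f : A → B) xs → countᵇ p (map f xs) ≡ countᵇ (p ∘ f) xs
  countᵇ-map p f [] = refl
  countᵇ-map p f (x ∷ xs) with p (f x)
  ... | true  = cong suc (countᵇ-map p f xs)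
  ... | false = countᵇ-map p f xs

  countᵇ+countᵇ-not : ∀ (p : A → Bool) xs → countᵇ p xs + countᵇ (not ∘ p) xs ≡ length xs
  countᵇ+countᵇ-not p [] = refl
  countᵇ+countᵇ-not p (x ∷ xs) with p x
  ... | true  = cong suc (countᵇ+countᵇ-not p xs)
  ... | false = trans (+-suc _ _) (cong suc (countᵇ+countᵇ-not p xs))

  countᵇ-filterᵇ : ∀ (p q : A → Bool) xs → countᵇ p (filterᵇ q xs) ≡ countᵇ (λ x → p x ∧ q x) xs
  countᵇ-filterᵇ p q [] = refl
  countᵇ-filterᵇ p q (x ∷ xs) with q x
  ... | false rewrite ∧-zeroʳ (p x) = countᵇ-filterᵇ p q xs
  ... | true with p x
  ...   | true  = cong suc (countᵇ-filterᵇ p q xs)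
  ...   | false = countᵇ-filterᵇ p q xs

  countᵇ-not-∧ : ∀ (p q : A → Bool) xs →
    countᵇ (λ x → not (p x ∧ q x)) xs ≤ countᵇ (not ∘ p) xs + countᵇ (not ∘ q) xs
  countᵇ-not-∧ p q [] = z≤n
  countᵇ-not-∧ p q (x ∷ xs) with p x | q x
  ... | true  | true  = countᵇ-not-∧ p q xs
  ... | true  | false = ≤-trans (s≤s (countᵇ-not-∧ p q xs)) (≤-reflexive (sym (+-suc _ _)))
  ... | false | true  = s≤s (countᵇ-not-∧ p q xs)
  ... | false | false = s≤s (≤-trans (countᵇ-not-∧ p q xs) (+-monoʳ-≤ _ (n≤1+n _)))

  countᵇ-not-none : ∀ (p : A → Bool) xs → ¬ Any (T ∘ p) xs → countᵇ (not ∘ p) xs ≡ length xs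
  countᵇ-not-none p [] _ = refl
  countᵇ-not-none p (x ∷ xs) none with p x in px
  ... | true  = ⊥-elim (none (here (Equivalence.from T-≡ px)))
  ... | false = cong suc (countᵇ-not-none p xs (none ∘ there))

  count≡countᵇ-tabulate : ∀ n (p : A → Bool) (f : Fin n → A) → count n (p ∘ f) ≡ countᵇ p (tabulate f)
  count≡countᵇ-tabulate zero    p f = refl
  count≡countᵇ-tabulate (suc n) p f with p (f zero)
  ... | true  = cong suc (count≡countᵇ-tabulate n p (f ∘ suc))
  ... | false = count≡countᵇ-tabulate n p (f ∘ suc)

  count≡countᵇ-allFin : ∀ n (p : Fin n → Bool) → count n p ≡ countᵇ p (allFin n)
  count≡countᵇ-allFin n p = count≡countᵇ-tabulate n p (λ i → i)

  infix 4 _⊑_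

  _⊑_ : List A → List A → Set
  xs ⊑ ys = ∃ λ rest → xs ++ rest ↭ ys

  ⊑-++ˡ : ∀ (xs ys : List A) → xs ⊑ xs ++ ys
  ⊑-++ˡ xs ys = ys , ↭-refl

  ⊑-++ʳ : ∀ (xs ys : List A) → ys ⊑ xs ++ ys
  ⊑-++ʳ xs ys = xs , ++-comm ys xs

  ↭⇒⊑ : xs ↭ ys → xs ⊑ ys
  ↭⇒⊑ xs↭ys = [] , ↭-trans (↭-reflexive (++-identityʳ _)) xs↭ys

  ⊑-trans : xs ⊑ ys → ys ⊑ zs → xs ⊑ zs
  ⊑-trans {xs = xs} (us , xsus↭ys) (vs , ysvs↭zs) =
    us ++ vs , ↭-trans (↭-reflexive (sym (++-assoc xs us vs))) (↭-trans (++⁺ʳ vs xsus↭ys) ysvs↭zs)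

  ∈-⊑ : x ∈ xs → xs ⊑ ys → x ∈ ys
  ∈-⊑ x∈xs (_ , xszs↭ys) = ∈-resp-↭ xszs↭ys (∈-++⁺ˡ x∈xs)

  countᵇ-mono-⊑ : ∀ (p : A → Bool) → xs ⊑ ys → countᵇ p xs ≤ countᵇ p ys
  countᵇ-mono-⊑ {xs = xs} p (zs , xszs↭ys) =
    ≤-trans (m≤m+n _ _) (≤-reflexive (trans (sym (countᵇ-++ p xs zs)) (countᵇ-↭ p xszs↭ys)))

  ∈⇒↭∷ : x ∈ xs → ∃ λ rest → xs ↭ x ∷ rest
  ∈⇒↭∷ x∈xs with ys , zs , refl ← ∈-∃++ x∈xs = ys ++ zs , shift _ ys zs

  classes : (A → Fin 3) → Fin 3 → List A → List A
  classes f j = filterᵇ (λ x → does (f x ≟ j))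

  ↭-partition₃ : ∀ (f : A → Fin 3) xs → xs ↭ classes f zero xs ++ classes f (suc zero) xs ++ classes f (suc (suc zero)) xs
  ↭-partition₃ f [] = ↭-refl
  ↭-partition₃ f (x ∷ xs) with f x
  ... | zero           = prep x (↭-partition₃ f xs)
  ... | suc zero       = ↭-trans (prep x (↭-partition₃ f xs)) (↭-sym (shift x (classes f zero xs) _))
  ... | suc (suc zero) = ↭-trans (prep x (↭-partition₃ f xs))
    (↭-trans (↭-sym (shift x (classes f zero xs) _))
             (++⁺ˡ (classes f zero xs) (↭-sym (shift x (classes f (suc zero) xs) (classes f (suc (suc zero)) xs)))))

  length-take-+ : ∀ a {b} {L : List A} → length L ≡ a + b → length (take a L) ≡ a
  length-take-+ a {L = L} |L| = trans (length-take a L) (trans (cong (a ⊓_) |L|) (m≤n⇒m⊓n≡m (m≤m+n a _)))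

  length-drop-+ : ∀ a {b} {L : List A} → length L ≡ a + b → length (drop a L) ≡ b
  length-drop-+ a {L = L} |L| = trans (length-drop a L) (trans (cong (_∸ a) |L|) (m+n∸m≡n a _))

  record Split₄ (L : List A) (a b c e : ℕ) : Set where
    field
      piece₁ piece₂ piece₃ piece₄ : List A
      pieces   : L ≡ piece₁ ++ piece₂ ++ piece₃ ++ piece₄
      |piece₁| : length piece₁ ≡ a
      |piece₂| : length piece₂ ≡ b
      |piece₃| : length piece₃ ≡ c
      |piece₄| : length piece₄ ≡ e

    piece₁⊑ : piece₁ ⊑ L
    piece₁⊑ rewrite pieces = ⊑-++ˡ piece₁ _

    piece₂⊑ : piece₂ ⊑ L
    piece₂⊑ rewrite pieces = ⊑-trans (⊑-++ˡ piece₂ _) (⊑-++ʳ piece₁ _)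

    piece₃₄⊑ : piece₃ ++ piece₄ ⊑ L
    piece₃₄⊑ rewrite pieces = ⊑-trans (⊑-++ʳ piece₂ _) (⊑-++ʳ piece₁ _)

  split₄ : ∀ {a b c e} (L : List A) → length L ≡ a + (b + (c + e)) → Split₄ L a b c e
  split₄ {a = a} {b} {c} L |L| = record
    { piece₁   = take a L
    ; piece₂   = take b L₁
    ; piece₃   = take c L₂
    ; piece₄   = drop c L₂
    ; pieces   = sym (trans (cong (take a L ++_) (trans (cong (take b L₁ ++_) (take++drop≡id c L₂)) (take++drop≡id b L₁)))
                            (take++drop≡id a L))
    ; |piece₁| = length-take-+ a |L|
    ; |piece₂| = length-take-+ b |L₁|
    ; |piece₃| = length-take-+ c |L₂|
    ; |piece₄| = length-drop-+ c |L₂|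
    }
    where
    L₁ = drop a L
    L₂ = drop b L₁
    |L₁| = length-drop-+ a |L|
    |L₂| = length-drop-+ b |L₁|

  All-comap : ∀ {P : B → Set} (f : A → B) → map f xs ↭ ys → All P ys → All (P ∘ f) xs
  All-comap f fxs↭ys pys = All.map⁻ (All-resp-↭ (↭-sym fxs↭ys) pys)


module BipartiteMatching where

  open import Data.List.Relation.Unary.All using ([]; _∷_)
  open import Data.Nat using (_+_; _*_; _≤_; _<_)
  open import Data.Nat.Properties
    using (≤-trans; ≤-reflexive; <⇒≱; +-mono-≤; +-identityʳ; suc-injective; module ≤-Reasoning)
  open Lists

  record AlmostComplete (E : A → B → Bool) (d : ℕ) (X : List A) (Y : List B) : Set where
    field
      missesˡ : ∀ {x} → x ∈ X → countᵇ (not ∘ E x) Y ≤ d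
      missesʳ : ∀ {y} → y ∈ Y → countᵇ (not ∘ flip E y) X ≤ d
  open AlmostComplete

  module _ {E : A → B → Bool} where

    AlmostComplete-⊑ : ∀ {d} → X′ ⊑ X → Y′ ⊑ Y → AlmostComplete E d X Y → AlmostComplete E d X′ Y′
    AlmostComplete-⊑ X′⊑X Y′⊑Y ac = record
      { missesˡ = λ x∈ → ≤-trans (countᵇ-mono-⊑ _ Y′⊑Y) (missesˡ ac (∈-⊑ x∈ X′⊑X))
      ; missesʳ = λ y∈ → ≤-trans (countᵇ-mono-⊑ _ X′⊑X) (missesʳ ac (∈-⊑ y∈ Y′⊑Y))
      }

    AlmostComplete-flip : ∀ {d} → AlmostComplete E d X Y → AlmostComplete (flip E) d Y X
    AlmostComplete-flip ac = record { missesˡ = missesʳ ac ; missesʳ = missesˡ ac }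

    AlmostComplete-comap : ∀ {d} (f : A′ → A) → map f X′ ↭ X →
                           AlmostComplete E d X Y → AlmostComplete (E ∘ f) d X′ Y
    AlmostComplete-comap {X′ = X′} f fX′↭X ac = record
      { missesˡ = λ x∈ → missesˡ ac (∈-resp-↭ fX′↭X (∈-map⁺ f x∈))
      ; missesʳ = λ {y} y∈ → ≤-trans
          (≤-reflexive (trans (sym (countᵇ-map (not ∘ flip E y) f X′)) (countᵇ-↭ _ fX′↭X)))
          (missesʳ ac y∈)
      }

    AlmostComplete-∧ : ∀ {d e} {F : A → B → Bool} → AlmostComplete E d X Y → AlmostComplete F e X Y →
                       AlmostComplete (λ x y → E x y ∧ F x y) (d + e) X Y
    AlmostComplete-∧ {X = X} {Y = Y} {F = F} acE acF = record
      { missesˡ = λ {x} x∈ → ≤-trans (countᵇ-not-∧ (E x) (F x) Y)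
                                      (+-mono-≤ (missesˡ acE x∈) (missesˡ acF x∈))
      ; missesʳ = λ {y} y∈ → ≤-trans (countᵇ-not-∧ (flip E y) (flip F y) X)
                                      (+-mono-≤ (missesʳ acE y∈) (missesʳ acF y∈))
      }

  record Matching (E : A → B → Bool) (X : List A) (Y : List B) : Set where
    field
      pairs   : List (A × B)
      edges   : All (T ∘ uncurry E) pairs
      covers₁ : map proj₁ pairs ↭ X
      covers₂ : map proj₂ pairs ↭ Y

    length-pairs : length pairs ≡ length X
    length-pairs = trans (sym (length-map proj₁ pairs)) (↭-length covers₁)

  record PartialMatching (E : A → B → Bool) (X : List A) (Y : List B) (freeˡ : List A) : Set where
    constructor partial
    field
      freeʳ    : List B
      pairs    : List (A × B)
      balanced : length freeˡ ≡ length freeʳ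
      edges    : All (T ∘ uncurry E) pairs
      coversˡ  : freeˡ ++ map proj₁ pairs ↭ X
      coversʳ  : freeʳ ++ map proj₂ pairs ↭ Y

  module _ {E : A → B → Bool} {d : ℕ} {X : List A} {Y : List B}
           (ac : AlmostComplete E d X Y) (large : 3 * d < length X) where

    swappable : A → B → A × B → Bool
    swappable x y (x′ , y′) = E x y′ ∧ E x′ y

    -- If x has no free neighbour and no matched edge x′y′ can be rerouted into x y′, x′ y, then every
    -- free vertex of Y is a non-neighbour of x and every matched edge meets a non-neighbour of x or y.
    stuck⇒small : ∀ {x xs y ys M} → length (x ∷ xs) ≡ length (y ∷ ys) →
                  (x ∷ xs) ++ map proj₁ M ↭ X → (y ∷ ys) ++ map proj₂ M ↭ Y →
                  ¬ Any (T ∘ E x) (y ∷ ys) → ¬ Any (T ∘ swappable x y) M → length X ≤ 3 * d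
    stuck⇒small {x} {xs} {y} {ys} {M} balanced coversˡ coversʳ no-free no-swap = begin
      length X                          ≡⟨ sym (↭-length coversˡ) ⟩
      length ((x ∷ xs) ++ map proj₁ M)  ≡⟨ length-++ (x ∷ xs) ⟩
      length (x ∷ xs) + length (map proj₁ M) ≡⟨ cong₂ _+_ balanced (length-map proj₁ M) ⟩
      length (y ∷ ys) + length M        ≤⟨ +-mono-≤ free-small matched-small ⟩
      d + (d + d)                       ≡⟨ cong (λ z → d + (d + z)) (sym (+-identityʳ d)) ⟩
      3 * d                             ∎
      where
      open ≤-Reasoning
      x∈X = ∈-resp-↭ coversˡ (here refl)
      y∈Y = ∈-resp-↭ coversʳ (here refl)
      free-small : length (y ∷ ys) ≤ d
      free-small = ≤-trans (≤-reflexive (sym (countᵇ-not-none (E x) (y ∷ ys) no-free)))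
                     (≤-trans (countᵇ-mono-⊑ {xs = y ∷ ys} _ (_ , coversʳ)) (missesˡ ac x∈X))
      matched-small : length M ≤ d + d
      matched-small = begin
        length M ≡⟨ sym (countᵇ-not-none (swappable x y) M no-swap) ⟩
        countᵇ (not ∘ swappable x y) M ≤⟨ countᵇ-not-∧ (E x ∘ proj₂) (flip E y ∘ proj₁) M ⟩
        countᵇ (not ∘ E x ∘ proj₂) M + countᵇ (not ∘ flip E y ∘ proj₁) M
          ≡⟨ cong₂ _+_ (sym (countᵇ-map _ proj₂ M)) (sym (countᵇ-map _ proj₁ M)) ⟩
        countᵇ (not ∘ E x) (map proj₂ M) + countᵇ (not ∘ flip E y) (map proj₁ M)
          ≤⟨ +-mono-≤ (countᵇ-mono-⊑ _ (⊑-trans (⊑-++ʳ (y ∷ ys) _) (↭⇒⊑ coversʳ)))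
                      (countᵇ-mono-⊑ _ (⊑-trans (⊑-++ʳ (x ∷ xs) _) (↭⇒⊑ coversˡ))) ⟩
        countᵇ (not ∘ E x) Y + countᵇ (not ∘ flip E y) X
          ≤⟨ +-mono-≤ (missesˡ ac x∈X) (missesʳ ac y∈Y) ⟩
        d + d ∎

    step : ∀ x xs → PartialMatching E X Y (x ∷ xs) → PartialMatching E X Y xs
    step x xs (partial [] M () _ _ _)
    step x xs (partial (y ∷ ys) M balanced edges coversˡ coversʳ)
      with any? (T? ∘ E x) (y ∷ ys)
    ... | yes x→free = matchFree (find x→free)
      where
      matchFree : ∃[ y′ ] y′ ∈ y ∷ ys × T (E x y′) → PartialMatching E X Y xs
      matchFree (y′ , y′∈ , xy′) with ys′ , free↭ ← ∈⇒↭∷ y′∈ = record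
        { freeʳ    = ys′
        ; pairs    = (x , y′) ∷ M
        ; balanced = suc-injective (trans balanced (↭-length free↭))
        ; edges    = xy′ ∷ edges
        ; coversˡ  = ↭-trans (shift x xs _) coversˡ
        ; coversʳ  = ↭-trans (shift y′ ys′ _) (↭-trans (++⁺ʳ _ (↭-sym free↭)) coversʳ)
        }
    ... | no ¬x→free with any? (T? ∘ swappable x y) M
    ...   | yes can-swap = reroute (find can-swap)
      where
      reroute : ∃[ p ] p ∈ M × T (swappable x y p) → PartialMatching E X Y xs
      reroute ((x′ , y′) , p∈ , xy′∧x′y)
        with M′ , M↭ ← ∈⇒↭∷ p∈ with xy′ , x′y ← Equivalence.to T-∧ xy′∧x′y = record
        { freeʳ    = ys
        ; pairs    = (x , y′) ∷ (x′ , y) ∷ M′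
        ; balanced = suc-injective balanced
        ; edges    = xy′ ∷ x′y ∷ All.tail (All-resp-↭ M↭ edges)
        ; coversˡ  = ↭-trans (shift x xs _) (↭-trans (++⁺ˡ (x ∷ xs) (↭-sym (map⁺ proj₁ M↭))) coversˡ)
        ; coversʳ  = ↭-trans (++⁺ˡ ys (swap y′ y ↭-refl))
                       (↭-trans (shift y ys _) (↭-trans (++⁺ˡ (y ∷ ys) (↭-sym (map⁺ proj₂ M↭))) coversʳ))
        }
    ...   | no ¬can-swap = ⊥-elim (<⇒≱ large (stuck⇒small balanced coversˡ coversʳ ¬x→free ¬can-swap))

    grow : ∀ xs → PartialMatching E X Y xs → Matching E X Y
    grow []       (partial [] M _ edges coversˡ coversʳ) = record
      { pairs = M ; edges = edges ; covers₁ = coversˡ ; covers₂ = coversʳ }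
    grow []       (partial (_ ∷ _) _ () _ _ _)
    grow (x ∷ xs) s = grow xs (step x xs s)

  perfectMatching : ∀ {d} {E : A → B → Bool} {X Y} → AlmostComplete E d X Y →
                    length X ≡ length Y → 3 * d < length X → Matching E X Y
  perfectMatching {X = X} {Y} ac |X|≡|Y| large = grow ac large X
    (partial Y [] |X|≡|Y| [] (↭-reflexive (++-identityʳ X)) (↭-reflexive (++-identityʳ Y)))

module QuadTiles where

  open import Data.Vec as Vec using ([]; _∷_)
  open import Data.List.Relation.Unary.All using ([]; _∷_)
  open import Data.List.Relation.Unary.AllPairs using ([]; _∷_)
  open import Data.Nat using (_+_; _*_; _<_)
  open import Data.Nat.Properties using (≤-<-trans; *-monoʳ-≤; m≤m+n)
  open Lists
  open BipartiteMatching

  Quad : Set → Set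
  Quad W = ((W × W) × W) × W

  corners : Quad W → List W
  corners (((a , b) , c) , e) = a ∷ b ∷ c ∷ e ∷ []

  closesTriangle : (W → W → Bool) → W × W → W → Bool
  closesTriangle R (a , b) c = R b c ∧ R c a

  IsQuadTile : (W → W → Bool) → Quad W → Set
  IsQuadTile R (((a , b) , c) , e) = T (R a b) × T (closesTriangle R (a , b) c) × T (closesTriangle R (a , b) e)

  corners-↭ : ∀ {W : Set} (U : List (Quad W)) → concatMap corners U ↭
    map proj₁ (map proj₁ (map proj₁ U)) ++ map proj₂ (map proj₁ (map proj₁ U)) ++
    map proj₂ (map proj₁ U) ++ map proj₂ U
  corners-↭ [] = ↭-refl
  corners-↭ {W} ((((a , b) , c) , e) ∷ U) = ↭-trans (++⁺ˡ (a ∷ b ∷ c ∷ e ∷ []) (corners-↭ U))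
    (solve 8 (λ a b c e as bs cs es →
                 a ⊕ b ⊕ c ⊕ e ⊕ as ⊕ bs ⊕ cs ⊕ es ⊜ (a ⊕ as) ⊕ (b ⊕ bs) ⊕ (c ⊕ cs) ⊕ (e ⊕ es))
      ↭-refl (a ∷ []) (b ∷ []) (c ∷ []) (e ∷ []) _ _ _ _)
    where open CommutativeMonoidSolver (++-commutativeMonoid {A = W}) using (solve; _⊜_; _⊕_)

  quadTiling : ∀ (R : W → W → Bool) {d x} (A B C₁ C₂ : List W) →
    length A ≡ x → length B ≡ x → length C₁ ≡ x → length C₂ ≡ x → 3 * (d + d) < x →
    AlmostComplete R d A B → AlmostComplete R d B (C₁ ++ C₂) → AlmostComplete R d (C₁ ++ C₂) A →
    ∃ λ (U : List (Quad W)) → All (IsQuadTile R) U × concatMap corners U ↭ A ++ B ++ C₁ ++ C₂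
  quadTiling {W} R {d} {x} A B C₁ C₂ |A| |B| |C₁| |C₂| large AB BC CA = M₃.pairs , tiles , cover
    where
    large′ : ∀ {W : Set} {L : List W} → length L ≡ x → 3 * (d + d) < length L
    large′ refl = large

    module M₁ = Matching (perfectMatching AB (trans |A| (sym |B|))
                  (≤-<-trans (*-monoʳ-≤ 3 (m≤m+n d d)) (large′ {L = A} |A|)))

    pairs→C : ∀ {C} → C ⊑ C₁ ++ C₂ → AlmostComplete (closesTriangle R) (d + d) M₁.pairs C
    pairs→C C⊑ = AlmostComplete-∧
      (AlmostComplete-comap proj₂ M₁.covers₂ (AlmostComplete-⊑ (↭⇒⊑ ↭-refl) C⊑ BC))
      (AlmostComplete-comap proj₁ M₁.covers₁ (AlmostComplete-flip (AlmostComplete-⊑ C⊑ (↭⇒⊑ ↭-refl) CA)))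

    |M₁| : length M₁.pairs ≡ x
    |M₁| = trans M₁.length-pairs |A|

    module M₂ = Matching (perfectMatching (pairs→C (⊑-++ˡ C₁ C₂))
                  (trans |M₁| (sym |C₁|)) (large′ {L = M₁.pairs} |M₁|))

    |M₂| : length M₂.pairs ≡ x
    |M₂| = trans M₂.length-pairs |M₁|

    module M₃ = Matching (perfectMatching (AlmostComplete-comap proj₁ M₂.covers₁ (pairs→C (⊑-++ʳ C₁ C₂)))
                  (trans |M₂| (sym |C₂|)) (large′ {L = M₂.pairs} |M₂|))

    tiles : All (IsQuadTile R) M₃.pairs
    tiles = All.zip (All-comap proj₁ M₃.covers₁ (All-comap proj₁ M₂.covers₁ M₁.edges) ,
                     All.zip (All-comap proj₁ M₃.covers₁ M₂.edges , M₃.edges))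

    triples↭pairs : map proj₁ (map proj₁ M₃.pairs) ↭ M₁.pairs
    triples↭pairs = ↭-trans (map⁺ proj₁ M₃.covers₁) M₂.covers₁

    cover : concatMap corners M₃.pairs ↭ A ++ B ++ C₁ ++ C₂
    cover = ↭-trans (corners-↭ M₃.pairs)
      (++⁺ (↭-trans (map⁺ proj₁ triples↭pairs) M₁.covers₁)
      (++⁺ (↭-trans (map⁺ proj₂ triples↭pairs) M₁.covers₂)
      (++⁺ (↭-trans (map⁺ proj₂ M₃.covers₁) M₂.covers₂)
           M₃.covers₂)))

  flatten : ∀ {m} → List (Fin m → W) → List W
  flatten = concatMap tabulate

  lookup-∈-flatten : ∀ {m} (ts : List (Fin m → W)) j i → lookup ts j i ∈ flatten ts
  lookup-∈-flatten (t ∷ ts) zero    i = ∈-++⁺ˡ (∈-tabulate⁺ i)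
  lookup-∈-flatten (t ∷ ts) (suc j) i = ∈-++⁺ʳ (tabulate t) (lookup-∈-flatten ts j i)

  ∈-flatten⁻ : ∀ {m} (ts : List (Fin m → W)) {v} → v ∈ flatten ts → ∃₂ λ j i → lookup ts j i ≡ v
  ∈-flatten⁻ (t ∷ ts) v∈ with ∈-++⁻ (tabulate t) v∈
  ... | inj₁ v∈t  with i , v≡ti ← ∈-tabulate⁻ v∈t = zero , i , sym v≡ti
  ... | inj₂ v∈ts with j , i , eq ← ∈-flatten⁻ ts v∈ts = suc j , i , eq

  Unique-++⁻ : ∀ (xs : List A) {ys} → Unique (xs ++ ys) → Unique xs × Unique ys × (∀ {v} → v ∈ xs → v ∈ ys → ⊥)
  Unique-++⁻ []       u         = [] , u , λ ()
  Unique-++⁻ (x ∷ xs) (x∉ ∷ u) with uxs , uys , disjoint ← Unique-++⁻ xs u =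
    All.++⁻ˡ xs x∉ ∷ uxs , uys , λ { (here refl) v∈ys → All.lookup (All.++⁻ʳ xs x∉) v∈ys refl
                                   ; (there v∈xs) → disjoint v∈xs }

  tabulate-injective : ∀ {m} {f : Fin m → W} → Unique (tabulate f) → Injective _≡_ _≡_ f
  tabulate-injective _         {zero}  {zero}  _  = refl
  tabulate-injective (f0∉ ∷ _) {zero}  {suc j} eq = ⊥-elim (All.lookup f0∉ (∈-tabulate⁺ j) eq)
  tabulate-injective (f0∉ ∷ _) {suc i} {zero}  eq = ⊥-elim (All.lookup f0∉ (∈-tabulate⁺ i) (sym eq))
  tabulate-injective (_ ∷ u)   {suc i} {suc j} eq = cong suc (tabulate-injective u eq)

  flatten-injective : ∀ {m} (ts : List (Fin m → W)) → Unique (flatten ts) → Injective _≡_ _≡_ (uncurry (lookup ts))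
  flatten-injective (t ∷ ts) u {j , i} {j′ , i′} eq with Unique-++⁻ (tabulate t) u | j | j′
  ... | uₜ , _ , _ | zero | zero = cong (zero ,_) (tabulate-injective uₜ eq)
  ... | _ , _ , disjoint | zero | suc j″ =
    ⊥-elim (disjoint (∈-tabulate⁺ i) (subst (_∈ flatten ts) (sym eq) (lookup-∈-flatten ts j″ i′)))
  ... | _ , _ , disjoint | suc j″ | zero =
    ⊥-elim (disjoint (∈-tabulate⁺ i′) (subst (_∈ flatten ts) eq (lookup-∈-flatten ts j″ i)))
  ... | _ , uₜₛ , _ | suc _ | suc _ = cong (map₁ suc) (flatten-injective ts uₜₛ eq)

  lookup-bijective : ∀ {m n} (ts : List (Fin m → Fin n)) → flatten ts ↭ allFin n →
                     Bijective _≡_ _≡_ (uncurry (lookup ts))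
  lookup-bijective {n = n} ts ts↭ = flatten-injective ts unique , surjective
    where
    unique : Unique (flatten ts)
    unique = SetoidPermutation.Unique-resp-↭ (setoid _) (↭⇒↭ₛ (↭-sym ts↭)) (allFin⁺ n)
    surjective : ∀ v → ∃ λ p → ∀ {q} → q ≡ p → uncurry (lookup ts) q ≡ v
    surjective v with j , i , eq ← ∈-flatten⁻ ts (∈-resp-↭ (↭-sym ts↭) (∈-allFin v)) = (j , i) , λ { refl → eq }

  orient : (W → W → Bool) → Quad W → Fin 4 → W
  orient R (((a , b) , c) , e) = if R c e then Vec.lookup (a ∷ b ∷ c ∷ e ∷ []) else Vec.lookup (a ∷ b ∷ e ∷ c ∷ [])

  flatten-orient : ∀ (R : W → W → Bool) U → flatten (map (orient R) U) ↭ concatMap corners U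
  flatten-orient R [] = ↭-refl
  flatten-orient R ((((a , b) , c) , e) ∷ U) with R c e
  ... | true  = ++⁺ˡ (a ∷ b ∷ c ∷ e ∷ []) (flatten-orient R U)
  ... | false = ++⁺ (prep a (prep b (swap e c ↭-refl))) (flatten-orient R U)

  T⇒≡ : ∀ {β} → T β → β ≡ true
  T⇒≡ = Equivalence.to T-≡

  orient-isCopyOfD : ∀ {n} (G : Tournament n) q → IsQuadTile (adj G) q →
                     orient (adj G) q c₁ ≢ orient (adj G) q c₂ → IsCopyOfD G (orient (adj G) q)
  orient-isCopyOfD G (((a , b) , c) , e) (ab , bca , bea)
    with Equivalence.to T-∧ bca | Equivalence.to T-∧ bea | adj G c e in ce
  ... | bc , ca | be , ea | true  = λ _ → T⇒≡ ab , T⇒≡ bc , T⇒≡ be , T⇒≡ ca , T⇒≡ ea , ce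
  ... | bc , ca | be , ea | false = λ e≢c →
    T⇒≡ ab , T⇒≡ be , T⇒≡ bc , T⇒≡ ea , T⇒≡ ca , trans (oneWay G c e (e≢c ∘ sym)) (cong not ce)

  tilingFromQuads : ∀ {n} (G : Tournament n) (U : List (Quad (Fin n))) →
                    All (IsQuadTile (adj G)) U → concatMap corners U ↭ allFin n → PerfectDTiling G
  tilingFromQuads G U tiles U↭ = record
    { k      = length ts
    ; tiles  = lookup ts
    ; copies = λ j → All.lookup copies-if-distinct (∈-lookup j) (λ eq → c₁≢c₂ (cong proj₂ (proj₁ bijective eq)))
    ; bij    = bijective
    }
    where
    ts = map (orient (adj G)) U
    bijective = lookup-bijective ts (↭-trans (flatten-orient (adj G) U) U↭)
    copies-if-distinct : All (λ t → t c₁ ≢ t c₂ → IsCopyOfD G t) ts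
    copies-if-distinct = All.map⁺ (All.map (orient-isCopyOfD G _) tiles)
    c₁≢c₂ : c₁ ≢ c₂
    c₁≢c₂ ()

module Arithmetic where

  open import Data.Nat using (_+_; _*_; _/_; _≤_; _<_)
  open import Data.Nat.Properties
    using (≤-trans; ≤-reflexive; *-comm; +-mono-≤; +-monoʳ-≤; *-monoʳ-≤; +-cancelˡ-≤; +-cancelʳ-≤; +-cancelʳ-≡;
           *-cancelˡ-≤; *-cancelˡ-<; m≤m+n; m<m+n; module ≤-Reasoning)
  open import Data.Nat.DivMod using (m/n*n≤m; m*n/n≡m; /-monoˡ-≤)
  open import Data.Nat.Tactic.RingSolver using (solve)

  -- (1/3 - 1/300) n ≤ s, i.e. 33n/100 ≤ s, cleared of denominators.
  AlmostThird : ℕ → ℕ → Set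
  AlmostThird n s = 33 * n ≤ 100 * s

  ≤/100 : ∀ {m n} → 100 * m ≤ n → m ≤ n / 100
  ≤/100 {m} {n} 100m≤n = subst (_≤ n / 100) (m*n/n≡m m 100) (/-monoˡ-≤ 100 (subst (_≤ n) (*-comm 100 m) 100m≤n))

  few-misses : ∀ {n s s′ s″ o m} → s′ + s + s″ ≡ n → AlmostThird n s′ → AlmostThird n s″ →
               o + m ≡ s → AlmostThird n o → m ≤ n / 100
  few-misses {n} {s} {s′} {s″} {o} {m} sum large′ large″ o+m≡s large-o =
    ≤/100 {m} {n} (+-cancelʳ-≤ (99 * n) (100 * m) n (begin
    100 * m + 99 * n                        ≡⟨ split-99 ⟩
    100 * m + 33 * n + 33 * n + 33 * n      ≤⟨ +-mono-≤ (+-mono-≤ (+-monoʳ-≤ (100 * m) large-o) large′) large″ ⟩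
    100 * m + 100 * o + 100 * s′ + 100 * s″ ≡⟨ factor-100 ⟩
    100 * (s′ + (o + m) + s″)               ≡⟨ cong (λ t → 100 * (s′ + t + s″)) o+m≡s ⟩
    100 * (s′ + s + s″)                     ≡⟨ cong (100 *_) sum ⟩
    100 * n                                 ≡⟨ split-100 ⟩
    n + 99 * n                              ∎))
    where
    open ≤-Reasoning
    split-99 : 100 * m + 99 * n ≡ 100 * m + 33 * n + 33 * n + 33 * n
    split-99 = solve (m ∷ n ∷ [])
    factor-100 : 100 * m + 100 * o + 100 * s′ + 100 * s″ ≡ 100 * (s′ + (o + m) + s″)
    factor-100 = solve (m ∷ o ∷ s′ ∷ s″ ∷ [])
    split-100 : 100 * n ≡ n + 99 * n
    split-100 = solve (n ∷ [])

  AlmostThird-positive : ∀ {n s} → 0 < n → AlmostThird n s → 0 < s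
  AlmostThird-positive {suc _} {zero}  _ ()
  AlmostThird-positive {_}     {suc _} _ _ = s≤s z≤n

  quarter-positive : ∀ {n k} → n ≡ k * 4 → 0 < n → 0 < k
  quarter-positive {k = zero}  refl ()
  quarter-positive {k = suc _} _    _ = s≤s z≤n

  AlmostThird-quarter≤ : ∀ {n k s} → n ≡ k * 4 → AlmostThird n s → k ≤ s
  AlmostThird-quarter≤ {n} {k} {s} refl large = *-cancelˡ-≤ 100 (begin
    100 * k            ≤⟨ m≤m+n (100 * k) (32 * k) ⟩
    100 * k + 32 * k   ≡⟨ solve (k ∷ []) ⟩
    33 * (k * 4)       ≤⟨ large ⟩
    100 * s            ∎)
    where open ≤-Reasoning

  large-surplus : ∀ {n k y} → n ≡ k * 4 → 0 < n → AlmostThird n (k + y) → 3 * (n / 100 + n / 100) < y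
  large-surplus {n} {k} {y} n≡4k 0<n = large-surplus′ {n / 100} {n} {k} {y} (m/n*n≤m n 100) n≡4k 0<n
    where
    large-surplus′ : ∀ {q n k y} → q * 100 ≤ n → n ≡ k * 4 → 0 < n → AlmostThird n (k + y) → 3 * (q + q) < y
    large-surplus′ {q} {n} {k} {y} q*100≤n n≡4k 0<n large = *-cancelˡ-< 100 _ _ (begin-strict
      100 * (3 * (q + q))   ≡⟨ solve (q ∷ []) ⟩
      6 * (q * 100)         ≤⟨ *-monoʳ-≤ 6 q*100≤n ⟩
      6 * n                 ≡⟨ cong (6 *_) n≡4k ⟩
      6 * (k * 4)           <⟨ m<m+n (6 * (k * 4)) (≤-trans (s≤s z≤n) (*-monoʳ-≤ 8 (quarter-positive {n} {k} n≡4k 0<n))) ⟩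
      6 * (k * 4) + 8 * k   ≤⟨ +-cancelˡ-≤ (100 * k) _ _ 132k≤100k+100y ⟩
      100 * y               ∎)
      where
      open ≤-Reasoning
      132k≤100k+100y : 100 * k + (6 * (k * 4) + 8 * k) ≤ 100 * k + 100 * y
      132k≤100k+100y = begin
        100 * k + (6 * (k * 4) + 8 * k) ≡⟨ solve (k ∷ []) ⟩
        33 * (k * 4)                    ≡⟨ cong (33 *_) n≡4k ⟨
        33 * n                          ≤⟨ large ⟩
        100 * (k + y)                   ≡⟨ solve (k ∷ y ∷ []) ⟩
        100 * k + 100 * y               ∎

  surplus-sum : ∀ {k a b c} → (k + a) + (k + b) + (k + c) ≡ k * 4 → a + b + c ≡ k
  surplus-sum {k} {a} {b} {c} sum = +-cancelʳ-≡ (k * 3) (a + b + c) k (begin-equality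
    a + b + c + k * 3 ≡⟨ solve (k ∷ a ∷ b ∷ c ∷ []) ⟩
    (k + a) + (k + b) + (k + c) ≡⟨ sum ⟩
    k * 4 ≡⟨ solve (k ∷ []) ⟩
    k + k * 3 ∎)
    where open ≤-Reasoning

  piece-sizes : ∀ {k a b c} → a + b + c ≡ k → k + b ≡ a + (c + (b + b))
  piece-sizes {k} {a} {b} {c} refl = solve (a ∷ b ∷ c ∷ [])

  rotate-sum : ∀ a b c {n} → a + b + c ≡ n → c + a + b ≡ n
  rotate-sum a b c sum = trans rotate sum
    where
    rotate : c + a + b ≡ a + b + c
    rotate = solve (a ∷ b ∷ c ∷ [])

prev3-next3 : ∀ i → prev3 (next3 i) ≡ i
prev3-next3 zero             = refl
prev3-next3 (suc zero)       = refl
prev3-next3 (suc (suc zero)) = refl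

next3-prev3 : ∀ i → next3 (prev3 i) ≡ i
next3-prev3 zero             = refl
next3-prev3 (suc zero)       = refl
next3-prev3 (suc (suc zero)) = refl

next3-next3 : ∀ i → next3 (next3 i) ≡ prev3 i
next3-next3 zero             = refl
next3-next3 (suc zero)       = refl
next3-next3 (suc (suc zero)) = refl

next3-or-prev3-or-self : ∀ i j → j ≡ next3 i ⊎ j ≡ prev3 i ⊎ j ≡ i
next3-or-prev3-or-self zero             zero             = inj₂ (inj₂ refl)
next3-or-prev3-or-self zero             (suc zero)       = inj₁ refl
next3-or-prev3-or-self zero             (suc (suc zero)) = inj₂ (inj₁ refl)
next3-or-prev3-or-self (suc zero)       zero             = inj₂ (inj₁ refl)
next3-or-prev3-or-self (suc zero)       (suc zero)       = inj₂ (inj₂ refl)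
next3-or-prev3-or-self (suc zero)       (suc (suc zero)) = inj₁ refl
next3-or-prev3-or-self (suc (suc zero)) zero             = inj₁ refl
next3-or-prev3-or-self (suc (suc zero)) (suc zero)       = inj₂ (inj₁ refl)
next3-or-prev3-or-self (suc (suc zero)) (suc (suc zero)) = inj₂ (inj₂ refl)

open Arithmetic using (AlmostThird)

module Construction {n : ℕ} (G : Tournament n) (part : Fin n → Fin 3) (4∣n : 4 ∣ n) (n≥1 : n ≥ 1)
  (out-large : ∀ v → AlmostThird n (outdegIn G (inPart part (next3 (part v))) v))
  (in-large  : ∀ v → AlmostThird n (indegIn G (inPart part (prev3 (part v))) v)) where

  open import Data.Nat using (_+_; _*_; _∸_; _/_; _≤_; _<_)
  open import Data.Nat.Properties using (≤-trans; ≤-reflexive; *-monoʳ-≤; m≤m+n; m+[n∸m]≡n; +-assoc)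
  open import Data.Nat.Divisibility using (module _∣_)
  open Lists
  open BipartiteMatching
  open QuadTiles
  open Arithmetic
  open _∣_ 4∣n renaming (quotient to k; equality to n≡4k)

  R : Fin n → Fin n → Bool
  R = adj G

  V : Fin 3 → List (Fin n)
  V j = filterᵇ (inPart part j) (allFin n)

  size : Fin 3 → ℕ
  size j = length (V j)

  v₀ : Fin n
  v₀ = fromℕ< n≥1

  ∈V⇒part : ∀ {j w} → w ∈ V j → part w ≡ j
  ∈V⇒part {j} {w} w∈ with part w ≟ j | proj₂ (∈-filter⁻ (T? ∘ inPart part j) {xs = allFin n} w∈)
  ... | yes part≡j | _ = part≡j
  ... | no _       | ()

  allFin↭V : allFin n ↭ V zero ++ V (suc zero) ++ V (suc (suc zero))
  allFin↭V = ↭-partition₃ part (allFin n)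

  size-sum : size zero + size (suc zero) + size (suc (suc zero)) ≡ n
  size-sum = begin
    size zero + size (suc zero) + size (suc (suc zero))   ≡⟨ +-assoc (size zero) _ _ ⟩
    size zero + (size (suc zero) + size (suc (suc zero))) ≡⟨ cong (λ s → size zero + s) (length-++ (V (suc zero))) ⟨
    size zero + length (V (suc zero) ++ V (suc (suc zero))) ≡⟨ length-++ (V zero) ⟨
    length (V zero ++ V (suc zero) ++ V (suc (suc zero)))  ≡⟨ ↭-length allFin↭V ⟨
    length (allFin n)                                      ≡⟨ length-tabulate (λ i → i) ⟩
    n ∎
    where open ≡-Reasoning

  size-sum-cyclic : ∀ j → size (prev3 j) + size j + size (next3 j) ≡ n
  size-sum-cyclic zero             = rotate-sum (size zero) (size (suc zero)) (size (suc (suc zero))) size-sum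
  size-sum-cyclic (suc zero)       = size-sum
  size-sum-cyclic (suc (suc zero)) = rotate-sum (size (suc (suc zero))) (size zero) (size (suc zero)) (size-sum-cyclic zero)

  restricted-split : ∀ (p : Fin n → Bool) j → count n (λ w → p w ∧ inPart part j w) + countᵇ (not ∘ p) (V j) ≡ size j
  restricted-split p j = trans
    (cong (_+ countᵇ (not ∘ p) (V j))
          (trans (count≡countᵇ-allFin n _) (sym (countᵇ-filterᵇ p (inPart part j) (allFin n)))))
    (countᵇ+countᵇ-not p (V j))

  restricted≤size : ∀ (p : Fin n → Bool) j → count n (λ w → p w ∧ inPart part j w) ≤ size j
  restricted≤size p j = ≤-trans (m≤m+n _ _) (≤-reflexive (restricted-split p j))

  large-next : ∀ {i} v → part v ≡ i → AlmostThird n (size (next3 i))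
  large-next v refl = ≤-trans (out-large v) (*-monoʳ-≤ 100 (restricted≤size (R v) _))

  large-prev : ∀ {i} v → part v ≡ i → AlmostThird n (size (prev3 i))
  large-prev v refl = ≤-trans (in-large v) (*-monoʳ-≤ 100 (restricted≤size (flip R v) _))

  nonempty : ∀ {xs : List (Fin n)} → 0 < length xs → ∃ λ w → w ∈ xs
  nonempty {w ∷ _} _ = w , here refl

  -- Some part is nonempty; it makes its two neighbours large, and a vertex of the next one makes it large too.
  all-large : ∀ j → AlmostThird n (size j)
  all-large j with next3-or-prev3-or-self (part v₀) j
  ... | inj₁ refl        = large-next v₀ refl
  ... | inj₂ (inj₁ refl) = large-prev v₀ refl
  ... | inj₂ (inj₂ refl) with w , w∈ ← nonempty (AlmostThird-positive n≥1 (large-next v₀ refl)) =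
    subst (AlmostThird n ∘ size) (prev3-next3 (part v₀)) (large-prev w (∈V⇒part w∈))

  d : ℕ
  d = n / 100

  out-misses : ∀ {i} v → part v ≡ i → countᵇ (not ∘ R v) (V (next3 i)) ≤ d
  out-misses v refl =
    few-misses {n} {size j} {size (prev3 j)} {size (next3 j)} {count n (λ w → R v w ∧ inPart part j w)}
      (size-sum-cyclic j) (all-large _) (all-large _) (restricted-split (R v) j) (out-large v)
    where j = next3 (part v)

  in-misses : ∀ {i} v → part v ≡ i → countᵇ (not ∘ flip R v) (V (prev3 i)) ≤ d
  in-misses v refl =
    few-misses {n} {size j} {size (prev3 j)} {size (next3 j)} {count n (λ w → R w v ∧ inPart part j w)}
      (size-sum-cyclic j) (all-large _) (all-large _) (restricted-split (flip R v) j) (in-large v)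
    where j = prev3 (part v)

  consecutive : ∀ {i j} → next3 i ≡ j → AlmostComplete R d (V i) (V j)
  consecutive {i} refl = record
    { missesˡ = λ v∈ → out-misses _ (∈V⇒part v∈)
    ; missesʳ = λ {w} w∈ →
        subst (λ l → countᵇ (not ∘ flip R w) (V l) ≤ d) (prev3-next3 i) (in-misses w (∈V⇒part w∈))
    }

  surplus : Fin 3 → ℕ
  surplus j = size j ∸ k

  size≡k+surplus : ∀ j → size j ≡ k + surplus j
  size≡k+surplus j = sym (m+[n∸m]≡n (AlmostThird-quarter≤ {n} {k} {size j} n≡4k (all-large j)))

  surplus-sum-cyclic : ∀ j → surplus (prev3 j) + surplus j + surplus (next3 j) ≡ k
  surplus-sum-cyclic j = surplus-sum (begin
    (k + surplus (prev3 j)) + (k + surplus j) + (k + surplus (next3 j))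
      ≡⟨ cong₂ _+_ (cong₂ _+_ (size≡k+surplus (prev3 j)) (size≡k+surplus j)) (size≡k+surplus (next3 j)) ⟨
    size (prev3 j) + size j + size (next3 j) ≡⟨ size-sum-cyclic j ⟩
    n                                        ≡⟨ n≡4k ⟩
    k * 4                                    ∎)
    where open ≡-Reasoning

  -- V j is cut into the a-vertices of the tiles of type j, the b-vertices of type prev3 j and the two
  -- c-vertices of type next3 j; there are surplus (prev3 t) tiles of type t.
  pieces : ∀ j → Split₄ (V j) (surplus (prev3 j)) (surplus (next3 j)) (surplus j) (surplus j)
  pieces j = split₄ (V j) (trans (size≡k+surplus j)
    (piece-sizes {k} {surplus (prev3 j)} {surplus j} {surplus (next3 j)} (surplus-sum-cyclic j)))

  module P (j : Fin 3) = Split₄ (pieces j)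

  enough-surplus : ∀ j → 3 * (d + d) < surplus j
  enough-surplus j =
    large-surplus {n} {k} {surplus j} n≡4k n≥1 (subst (AlmostThird n) (size≡k+surplus j) (all-large j))

  QuadsCovering : List (Fin n) → Set
  QuadsCovering L = ∃ λ U → All (IsQuadTile R) U × concatMap corners U ↭ L

  TypeCover : Fin 3 → List (Fin n)
  TypeCover t = P.piece₁ t ++ P.piece₂ (next3 t) ++ P.piece₃ (prev3 t) ++ P.piece₄ (prev3 t)

  quadsOfType : ∀ t → QuadsCovering (TypeCover t)
  quadsOfType t = quadTiling R {d} (P.piece₁ t) (P.piece₂ (next3 t)) (P.piece₃ (prev3 t)) (P.piece₄ (prev3 t))
    (P.|piece₁| t) (trans (P.|piece₂| (next3 t)) (cong surplus (next3-next3 t)))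
    (P.|piece₃| (prev3 t)) (P.|piece₄| (prev3 t)) (enough-surplus (prev3 t))
    (AlmostComplete-⊑ (P.piece₁⊑ t) (P.piece₂⊑ (next3 t)) (consecutive {t} refl))
    (AlmostComplete-⊑ (P.piece₂⊑ (next3 t)) (P.piece₃₄⊑ (prev3 t)) (consecutive {next3 t} (next3-next3 t)))
    (AlmostComplete-⊑ (P.piece₃₄⊑ (prev3 t)) (P.piece₁⊑ t) (consecutive {prev3 t} (next3-prev3 t)))

  regroup : ∀ (A₀ B₀ C₀ D₀ A₁ B₁ C₁ D₁ A₂ B₂ C₂ D₂ : List (Fin n)) →
    (A₀ ++ B₁ ++ C₂ ++ D₂) ++ (A₁ ++ B₂ ++ C₀ ++ D₀) ++ (A₂ ++ B₀ ++ C₁ ++ D₁) ↭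
    (A₀ ++ B₀ ++ C₀ ++ D₀) ++ (A₁ ++ B₁ ++ C₁ ++ D₁) ++ (A₂ ++ B₂ ++ C₂ ++ D₂)
  regroup = solve 12 (λ A₀ B₀ C₀ D₀ A₁ B₁ C₁ D₁ A₂ B₂ C₂ D₂ →
    (A₀ ⊕ B₁ ⊕ C₂ ⊕ D₂) ⊕ (A₁ ⊕ B₂ ⊕ C₀ ⊕ D₀) ⊕ (A₂ ⊕ B₀ ⊕ C₁ ⊕ D₁) ⊜
    (A₀ ⊕ B₀ ⊕ C₀ ⊕ D₀) ⊕ (A₁ ⊕ B₁ ⊕ C₁ ⊕ D₁) ⊕ (A₂ ⊕ B₂ ⊕ C₂ ⊕ D₂)) ↭-refl
    where open CommutativeMonoidSolver (++-commutativeMonoid {A = Fin n}) using (solve; _⊜_; _⊕_)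

  ++-quadsCovering : ∀ {L L′} → QuadsCovering L → QuadsCovering L′ → QuadsCovering (L ++ L′)
  ++-quadsCovering (U , tiles , U↭) (U′ , tiles′ , U′↭) =
    U ++ U′ , All.++⁺ tiles tiles′ , ↭-trans (↭-reflexive (concatMap-++ corners U U′)) (++⁺ U↭ U′↭)

  quadsCovering-↭ : ∀ {L L′} → L ↭ L′ → QuadsCovering L → QuadsCovering L′
  quadsCovering-↭ L↭L′ (U , tiles , U↭) = U , tiles , ↭-trans U↭ L↭L′

  types↭parts : TypeCover zero ++ TypeCover (suc zero) ++ TypeCover (suc (suc zero)) ↭ allFin n
  types↭parts = ↭-trans (regroup
      (P.piece₁ zero) (P.piece₂ zero) (P.piece₃ zero) (P.piece₄ zero)
      (P.piece₁ (suc zero)) (P.piece₂ (suc zero)) (P.piece₃ (suc zero)) (P.piece₄ (suc zero))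
      (P.piece₁ (suc (suc zero))) (P.piece₂ (suc (suc zero))) (P.piece₃ (suc (suc zero))) (P.piece₄ (suc (suc zero))))
    (↭-trans (↭-reflexive (sym (cong₂ _++_ (P.pieces zero) (cong₂ _++_ (P.pieces (suc zero)) (P.pieces (suc (suc zero)))))))
      (↭-sym allFin↭V))

  all-quads : QuadsCovering (allFin n)
  all-quads = quadsCovering-↭ types↭parts
    (++-quadsCovering (quadsOfType zero) (++-quadsCovering (quadsOfType (suc zero)) (quadsOfType (suc (suc zero)))))

  tiling : PerfectDTiling G
  tiling = tilingFromQuads G (proj₁ all-quads) (proj₁ (proj₂ all-quads)) (proj₂ (proj₂ all-quads))

module RationalBound where

  import Data.Nat as ℕ
  open import Data.Nat.Properties using (*-comm)
  import Data.Nat.Coprimality as Coprimality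
  import Data.Integer as ℤ
  import Data.Integer.Properties as ℤ
  open import Data.Rational using (mkℚ; toℚᵘ; _/_; _-_; _*_; _≤_)
  import Data.Rational.Properties as ℚ
  import Data.Rational.Unnormalised as ℚᵘ
  import Data.Rational.Unnormalised.Properties as ℚᵘ

  ℕ→ℚ≡mkℚ : ∀ n → ℕ→ℚ n ≡ mkℚ (+ n) 0 (Coprimality.sym (Coprimality.1-coprimeTo n))
  ℕ→ℚ≡mkℚ n = ℚ.normalize-coprime _

  ℚ-bound⇒AlmostThird : ∀ n N → (+ 1 / 3 - + 1 / 300) * ℕ→ℚ n ≤ ℕ→ℚ N → AlmostThird n N
  ℚ-bound⇒AlmostThird n N bound = subst (33 ℕ.* n ℕ.≤_) (*-comm N 100) (ℤ.drop‿+≤+ (subst₂ ℤ._≤_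
    (trans (ℤ.*-identityʳ _) (sym (ℤ.pos-* 33 n))) (sym (ℤ.pos-* N 100)) cross))
    where
    boundᵘ : toℚᵘ (+ 1 / 3 - + 1 / 300) ℚᵘ.* toℚᵘ (ℕ→ℚ n) ℚᵘ.≤ toℚᵘ (ℕ→ℚ N)
    boundᵘ = ℚᵘ.≤-respˡ-≃ (ℚ.toℚᵘ-homo-* (+ 1 / 3 - + 1 / 300) (ℕ→ℚ n)) (ℚ.toℚᵘ-mono-≤ bound)
    cross : (+ 33 ℤ.* + n) ℤ.* + 1 ℤ.≤ + N ℤ.* + 100
    cross with ℚᵘ.*≤* p ← subst₂ (λ a b → toℚᵘ (+ 1 / 3 - + 1 / 300) ℚᵘ.* toℚᵘ a ℚᵘ.≤ toℚᵘ b)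
                                  (ℕ→ℚ≡mkℚ n) (ℕ→ℚ≡mkℚ N) boundᵘ = p

open import Data.Rational using (ℚ; _/_; _-_; _*_; _≤_; Positive)

corollary5p21 :
    Σ ℚ λ c′ → Σ ℚ λ ξ → Σ ℕ λ n₀ →
      Positive c′ × Positive ξ ×
      (∀ (n : ℕ) → n ≥ n₀ → 4 ∣ n →
        ∀ (G : Tournament n) →
        MinSemidegreeAtLeast G ((+ 1 / 2 - c′) * ℕ→ℚ n) →
        ∀ (part : Fin n → Fin 3) →
        (∀ i → 4 ∣ partSize part i) →
        (∀ i (v : Fin n) → part v ≡ i →
          ((+ 1 / 3 - ξ) * ℕ→ℚ n ≤ ℕ→ℚ (outdegIn G (inPart part (next3 i)) v)) ×
          ((+ 1 / 3 - ξ) * ℕ→ℚ n ≤ ℕ→ℚ (indegIn G (inPart part (prev3 i)) v))) →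
        PerfectDTiling G)
corollary5p21 = ξ , ξ , 1 , _ , _ , λ n n≥1 4∣n G _ part _ degrees →
  Construction.tiling G part 4∣n n≥1
    (λ v → RationalBound.ℚ-bound⇒AlmostThird n (outdegIn G (inPart part (next3 (part v))) v) (proj₁ (degrees _ v refl)))
    (λ v → RationalBound.ℚ-bound⇒AlmostThird n (indegIn G (inPart part (prev3 (part v))) v) (proj₂ (degrees _ v refl)))
  where
  ξ : ℚ
  ξ = + 1 / 300
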